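{- Let $\mathbf{d}=d_0,d_1,\dots,d_n,\dots$ be an adequate numeral system (in the pure, untyped $\lambda$-calculus). Then $\mathbf{d}$ possesses a storage operator, i.e. there is a closed $\lambda$-term $O_d$ such that for every $n\in\mathbf{N}$ there exists a closed $\lambda$-term $\tau_n\simeq_\beta d_n$ such that for every $\lambda$-term $\theta_n\simeq_\beta d_n$ we have $(O_d\,\theta_n\,f)\succ(f\,\tau_n)$, where $f$ is a fresh variable.
   Context: Pure $\lambda$-calculus; $\simeq_\beta$ is $\beta$-equivalence. $T=\lambda x\lambda y\,x$, $F=\lambda x\lambda y\,y$. A $\lambda$-term either has a head redex, i.e. is of the form $\lambda x_1\dots\lambda x_n((\lambda x\,u)\,v\,v_1\dots v_m)$ with head redex $(\lambda x\,u)\,v$, or is in head normal form $\lambda x_1\dots\lambda x_n(x\,v_1\dots v_m)$. Head reduction contracts the head redex; $u\succ v$ means $v$ is obtained from $u$ by finitely many (possibly zero) head reduction steps. A numeral system is a sequence $\mathbf{d}=d_0,d_1,\dots$ of pairwise distinct closed normal $\lambda$-terms for which there exist closed $\lambda$-terms $S_d$ and $Z_d$ with $(S_d\,d_n)\simeq_\beta d_{n+1}$ for all $n$, $(Z_d\,d_0)\simeq_\beta T$ and $(Z_d\,d_{n+1})\simeq_\beta F$ for all $n$. It is adequate if there is a closed $\lambda$-term $P_d$ with $(P_d\,d_{n+1})\simeq_\beta d_n$ for all $n\in\mathbf{N}$. -}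

module Defs where

open import Data.Nat using (ℕ; zero; suc; _<ᵇ_; _≡ᵇ_; pred)
open import Data.Bool using (Bool; true; false; if_then_else_)
open import Data.Product using (Σ; _×_; _,_; ∃)
open import Relation.Nullary using (¬_)
open import Data.Empty using (⊥)
open import Data.Unit using (⊤)
open import Relation.Binary.PropositionalEquality using (_≡_)
open import Relation.Binary.Construct.Closure.ReflexiveTransitive using (Star)
open import Relation.Binary.Construct.Closure.Equivalence using (EqClosure)

-- Untyped λ-terms with de Bruijn indices (free variables are natural numbers).
data Λ : Set where
  var : ℕ → Λ
  lam : Λ → Λ
  app : Λ → Λ → Λ

shift : ℕ → Λ → Λ
shift c (var x) = if x <ᵇ c then var x else var (suc x)
shift c (lam t) = lam (shift (suc c) t)
shift c (app t u) = app (shift c t) (shift c u)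

subst : ℕ → Λ → Λ → Λ
subst j s (var x) = if x ≡ᵇ j then s else (if x <ᵇ j then var x else var (pred x))
subst j s (lam t) = lam (subst (suc j) (shift 0 s) t)
subst j s (app t u) = app (subst j s t) (subst j s u)

-- u[v/x] for the body u of λx.u
_[_] : Λ → Λ → Λ
u [ v ] = subst 0 v u

data _∈FV_ : ℕ → Λ → Set where
  here  : ∀ {k} → k ∈FV var k
  under : ∀ {k t} → suc k ∈FV t → k ∈FV lam t
  appˡ  : ∀ {k t u} → k ∈FV t → k ∈FV app t u
  appʳ  : ∀ {k t u} → k ∈FV u → k ∈FV app t u

Closed : Λ → Set
Closed t = ∀ k → ¬ (k ∈FV t)

data _→β_ : Λ → Λ → Set where
  beta : ∀ {u v} → app (lam u) v →β (u [ v ])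
  ξlam : ∀ {t t'} → t →β t' → lam t →β lam t'
  ξappˡ : ∀ {t t' u} → t →β t' → app t u →β app t' u
  ξappʳ : ∀ {t u u'} → u →β u' → app t u →β app t u'

Normal : Λ → Set
Normal t = ∀ t' → ¬ (t →β t')

_≃β_ : Λ → Λ → Set
_≃β_ = EqClosure _→β_

-- head reduction: contract the head redex of λx₁…λxₙ((λx u) v v₁…vₘ)
NotLam : Λ → Set
NotLam (lam _) = ⊥
NotLam _ = ⊤

data _→h_ : Λ → Λ → Set where
  hβ   : ∀ {u v} → app (lam u) v →h (u [ v ])
  happ : ∀ {t t' w} → NotLam t → t →h t' → app t w →h app t' w
  hlam : ∀ {t t'} → t →h t' → lam t →h lam t'

_≻_ : Λ → Λ → Set
_≻_ = Star _→h_

T F : Λ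
T = lam (lam (var 1))
F = lam (lam (var 0))

record NumeralSystem (d : ℕ → Λ) : Set where
  field
    closed   : ∀ n → Closed (d n)
    normal   : ∀ n → Normal (d n)
    distinct : ∀ m n → d m ≡ d n → m ≡ n
    S Z      : Λ
    S-closed : Closed S
    Z-closed : Closed Z
    S-spec   : ∀ n → app S (d n) ≃β d (suc n)
    Z-zero   : app Z (d 0) ≃β T
    Z-suc    : ∀ n → app Z (d (suc n)) ≃β F

Adequate : (ℕ → Λ) → Set
Adequate d = NumeralSystem d × Σ Λ (λ P → Closed P × (∀ n → app P (d (suc n)) ≃β d n))

HasStorageOperator : (ℕ → Λ) → Set
HasStorageOperator d =
  Σ Λ λ O → Closed O ×
    (∀ n → Σ Λ λ τ → Closed τ × (τ ≃β d n) ×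
       (∀ θ → θ ≃β d n → ∀ f → ¬ (f ∈FV θ) →
          app (app O θ) (var f) ≻ app (var f) τ))

module Submission where

open import Defs
open import Data.Nat
  using (ℕ; zero; suc; _<ᵇ_; _≡ᵇ_; pred; _<_; _≤_; _+_; _⊔_; z≤n; s≤s; z<s; s<s; sz<ss; _<?_)
open import Data.Nat.Properties
  using ( ≤-refl; n≤1+n; n<1+n; ≤-trans; <-≤-trans; <-cmp; ≮⇒≥; <⇒≢; m≤n⇒m≤1+n
        ; m≤m+n; m≤m⊔n; m≤n⊔m)
open import Data.Bool using (true; false)
open import Data.Product using (_×_; _,_; ∃)
open import Data.Empty using (⊥-elim)
open import Data.Unit using (tt)
open import Function using (_∘_)
open import Relation.Nullary using (yes; no)
open import Relation.Binary.Definitions using (tri<; tri≈; tri>)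
open import Relation.Binary.PropositionalEquality
  using (_≡_; _≢_; refl; sym; cong; cong₂)
  renaming (subst to transport)
open import Relation.Binary.Construct.Closure.ReflexiveTransitive using (Star; ε; _◅_; _◅◅_)
open import Relation.Binary.Construct.Closure.Symmetric using (fwd; bwd)
open import Relation.Binary.Construct.Closure.Equivalence using (gmap)

-- O = Θ H, with Turing's fixed point combinator Θ and
--   H o θ f = Z θ A₀ (B o) θ f,   A₀ θ f = f d₀,   B o θ f = o (P θ) (λx. f (S x)).
-- On θ ≃β dₙ₊₁ it calls itself on P θ ≃β dₙ with the continuation f wrapped in S, and on
-- θ ≃β d₀ it feeds d₀ to the continuation, so O θ f reduces to f (Sⁿ d₀).
-- That Z θ picks the right branch by head reduction, for an arbitrary θ ≃β dₙ, rests on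
-- standardisation towards variables: Z θ x y ≃β x (resp. y) for fresh x, y, and a term
-- β-equivalent to a variable weak-head reduces to it (proved with parallel reduction);
-- substituting the two branches for x and y then gives the required reduction.

<ᵇ-true : ∀ {x c} → x < c → (x <ᵇ c) ≡ true
<ᵇ-true {zero}  {suc c} _         = refl
<ᵇ-true {suc x} {suc c} (s≤s x<c) = <ᵇ-true x<c

<ᵇ-false : ∀ {x c} → c ≤ x → (x <ᵇ c) ≡ false
<ᵇ-false {x}     {zero}  _         = refl
<ᵇ-false {suc x} {suc c} (s≤s c≤x) = <ᵇ-false c≤x

≡ᵇ-refl : ∀ x → (x ≡ᵇ x) ≡ true
≡ᵇ-refl zero    = refl
≡ᵇ-refl (suc x) = ≡ᵇ-refl x

≡ᵇ-false : ∀ {x y} → x ≢ y → (x ≡ᵇ y) ≡ false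
≡ᵇ-false {zero}  {zero}  x≢y = ⊥-elim (x≢y refl)
≡ᵇ-false {zero}  {suc y} _   = refl
≡ᵇ-false {suc x} {zero}  _   = refl
≡ᵇ-false {suc x} {suc y} x≢y = ≡ᵇ-false (λ x≡y → x≢y (cong suc x≡y))

shift-var-< : ∀ {c x} → x < c → shift c (var x) ≡ var x
shift-var-< x<c rewrite <ᵇ-true x<c = refl

shift-var-≥ : ∀ {c x} → c ≤ x → shift c (var x) ≡ var (suc x)
shift-var-≥ c≤x rewrite <ᵇ-false c≤x = refl

subst-var-≡ : ∀ {j s} → subst j s (var j) ≡ s
subst-var-≡ {j} rewrite ≡ᵇ-refl j = refl

subst-var-< : ∀ {j s x} → x < j → subst j s (var x) ≡ var x
subst-var-< x<j rewrite ≡ᵇ-false (<⇒≢ x<j) | <ᵇ-true x<j = refl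

subst-var-> : ∀ {j s y} → j ≤ y → subst j s (var (suc y)) ≡ var y
subst-var-> j≤y
  rewrite ≡ᵇ-false (λ e → <⇒≢ (s≤s j≤y) (sym e)) | <ᵇ-false (m≤n⇒m≤1+n j≤y) = refl

shift-shift : ∀ c d t → c ≤ d → shift c (shift d t) ≡ shift (suc d) (shift c t)
shift-shift c d (var x) c≤d with x <? c | x <? d
... | yes x<c | _
  rewrite shift-var-< (<-≤-trans x<c c≤d) | shift-var-< x<c
        | shift-var-< {suc d} (m≤n⇒m≤1+n (<-≤-trans x<c c≤d)) = refl
... | no x≮c | yes x<d
  rewrite shift-var-< x<d | shift-var-≥ (≮⇒≥ x≮c) | shift-var-< (s<s x<d) = refl
... | no x≮c | no x≮d
  rewrite shift-var-≥ (≮⇒≥ x≮d) | shift-var-≥ (≮⇒≥ x≮c)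
        | shift-var-≥ (m≤n⇒m≤1+n (≮⇒≥ x≮c)) | shift-var-≥ (s≤s (≮⇒≥ x≮d)) = refl
shift-shift c d (lam t)   c≤d = cong lam (shift-shift (suc c) (suc d) t (s≤s c≤d))
shift-shift c d (app t u) c≤d = cong₂ app (shift-shift c d t c≤d) (shift-shift c d u c≤d)

subst-shift : ∀ c v t → subst c v (shift c t) ≡ t
subst-shift c v (var x) with x <? c
... | yes x<c rewrite shift-var-< x<c | subst-var-< {s = v} x<c = refl
... | no x≮c rewrite shift-var-≥ (≮⇒≥ x≮c) | subst-var-> {s = v} (≮⇒≥ x≮c) = refl
subst-shift c v (lam t)   = cong lam (subst-shift (suc c) (shift 0 v) t)
subst-shift c v (app t u) = cong₂ app (subst-shift c v t) (subst-shift c v u)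

shift-subst-≤ : ∀ c d s u → c ≤ d →
                shift c (subst d s u) ≡ subst (suc d) (shift c s) (shift c u)
shift-subst-≤ c d s (var x) c≤d with <-cmp x d
... | tri≈ _ refl _
  rewrite subst-var-≡ {x} {s} | shift-var-≥ c≤d | subst-var-≡ {suc x} {shift c s} = refl
... | tri< x<d _ _ with x <? c
...   | yes x<c
  rewrite subst-var-< {s = s} x<d | shift-var-< x<c
        | subst-var-< {s = shift c s} (m≤n⇒m≤1+n x<d) = refl
...   | no x≮c
  rewrite subst-var-< {s = s} x<d | shift-var-≥ (≮⇒≥ x≮c)
        | subst-var-< {s = shift c s} (s<s x<d) = refl
shift-subst-≤ c d s (var (suc y)) c≤d | tri> _ _ (s≤s d≤y)
  rewrite subst-var-> {s = s} d≤y | shift-var-≥ (≤-trans c≤d d≤y)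
        | shift-var-≥ (m≤n⇒m≤1+n (≤-trans c≤d d≤y))
        | subst-var-> {s = shift c s} (s≤s d≤y) = refl
shift-subst-≤ c d s (lam t) c≤d
  rewrite shift-subst-≤ (suc c) (suc d) (shift 0 s) t (s≤s c≤d)
        | shift-shift 0 c s z≤n = refl
shift-subst-≤ c d s (app t u) c≤d =
  cong₂ app (shift-subst-≤ c d s t c≤d) (shift-subst-≤ c d s u c≤d)

shift-subst-≥ : ∀ c d s u → d ≤ c →
                shift c (subst d s u) ≡ subst d (shift c s) (shift (suc c) u)
shift-subst-≥ c d s (var x) d≤c with <-cmp x d
... | tri≈ _ refl _
  rewrite subst-var-≡ {x} {s} | shift-var-< {suc c} (s≤s d≤c) | subst-var-≡ {x} {shift c s} = refl
... | tri< x<d _ _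
  rewrite subst-var-< {s = s} x<d | shift-var-< (<-≤-trans x<d d≤c)
        | shift-var-< {suc c} (m≤n⇒m≤1+n (<-≤-trans x<d d≤c))
        | subst-var-< {s = shift c s} x<d = refl
shift-subst-≥ c d s (var (suc y)) d≤c | tri> _ _ (s≤s d≤y) with y <? c
... | yes y<c
  rewrite subst-var-> {s = s} d≤y | shift-var-< y<c | shift-var-< (s<s y<c)
        | subst-var-> {s = shift c s} d≤y = refl
... | no y≮c
  rewrite subst-var-> {s = s} d≤y | shift-var-≥ (≮⇒≥ y≮c) | shift-var-≥ (s≤s (≮⇒≥ y≮c))
        | subst-var-> {s = shift c s} (m≤n⇒m≤1+n d≤y) = refl
shift-subst-≥ c d s (lam t) d≤c
  rewrite shift-subst-≥ (suc c) (suc d) (shift 0 s) t (s≤s d≤c)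
        | shift-shift 0 c s z≤n = refl
shift-subst-≥ c d s (app t u) d≤c =
  cong₂ app (shift-subst-≥ c d s t d≤c) (shift-subst-≥ c d s u d≤c)

subst-subst : ∀ k j S U t →
              subst (k + j) S (subst k U t)
                ≡ subst k (subst (k + j) S U) (subst (suc (k + j)) (shift k S) t)
subst-subst k j S U (var x) with <-cmp x k
... | tri< x<k _ _
  rewrite subst-var-< {s = U} x<k | subst-var-< {s = S} (≤-trans x<k (m≤m+n k j))
        | subst-var-< {s = shift k S} (m≤n⇒m≤1+n (≤-trans x<k (m≤m+n k j)))
        | subst-var-< {s = subst (k + j) S U} x<k = refl
... | tri≈ _ refl _
  rewrite subst-var-≡ {x} {U} | subst-var-< {s = shift x S} (s≤s (m≤m+n x j))
        | subst-var-≡ {x} {subst (x + j) S U} = refl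
subst-subst k j S U (var (suc y)) | tri> _ _ (s≤s k≤y) with <-cmp y (k + j)
... | tri< y<k+j _ _
  rewrite subst-var-> {s = U} k≤y | subst-var-< {s = S} y<k+j
        | subst-var-< {s = shift k S} (s<s y<k+j)
        | subst-var-> {s = subst (k + j) S U} k≤y = refl
... | tri≈ _ refl _
  rewrite subst-var-> {s = U} k≤y | subst-var-≡ {k + j} {S}
        | subst-var-≡ {suc (k + j)} {shift k S}
        | subst-shift k (subst (k + j) S U) S = refl
subst-subst k j S U (var (suc (suc z))) | tri> _ _ (s≤s k≤y) | tri> _ _ (s≤s k+j≤z)
  rewrite subst-var-> {s = U} k≤y | subst-var-> {s = S} k+j≤z
        | subst-var-> {s = shift k S} (s≤s k+j≤z)
        | subst-var-> {s = subst (k + j) S U} (≤-trans (m≤m+n k j) k+j≤z) = refl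
subst-subst k j S U (lam t)
  rewrite subst-subst (suc k) j (shift 0 S) (shift 0 U) t
        | shift-subst-≤ 0 (k + j) S U z≤n | shift-shift 0 k S z≤n = refl
subst-subst k j S U (app t u) = cong₂ app (subst-subst k j S U t) (subst-subst k j S U u)

shift-[] : ∀ c s u → shift c (u [ s ]) ≡ shift (suc c) u [ shift c s ]
shift-[] c s u = shift-subst-≥ c 0 s u z≤n

subst-[] : ∀ j S U t → subst j S (t [ U ]) ≡ subst (suc j) (shift 0 S) t [ subst j S U ]
subst-[] j = subst-subst 0 j

infix 4 _⇉_ _⇉ᵢ_ _→w_ _↠w_ _↠w⇉ᵢ_

data _⇉_ : Λ → Λ → Set where
  pvar  : ∀ {x} → var x ⇉ var x
  plam  : ∀ {t t'} → t ⇉ t' → lam t ⇉ lam t'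
  papp  : ∀ {t t' u u'} → t ⇉ t' → u ⇉ u' → app t u ⇉ app t' u'
  pbeta : ∀ {t t' u u'} → t ⇉ t' → u ⇉ u' → app (lam t) u ⇉ t' [ u' ]

⇉-refl : ∀ t → t ⇉ t
⇉-refl (var x)   = pvar
⇉-refl (lam t)   = plam (⇉-refl t)
⇉-refl (app t u) = papp (⇉-refl t) (⇉-refl u)

→β⇒⇉ : ∀ {t t'} → t →β t' → t ⇉ t'
→β⇒⇉ (beta {u} {v})       = pbeta (⇉-refl u) (⇉-refl v)
→β⇒⇉ (ξlam t→t')          = plam (→β⇒⇉ t→t')
→β⇒⇉ (ξappˡ {u = u} t→t') = papp (→β⇒⇉ t→t') (⇉-refl u)
→β⇒⇉ (ξappʳ {t = t} u→u') = papp (⇉-refl t) (→β⇒⇉ u→u')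

shift-⇉ : ∀ c {t t'} → t ⇉ t' → shift c t ⇉ shift c t'
shift-⇉ c (pvar {x})   = ⇉-refl (shift c (var x))
shift-⇉ c (plam p)     = plam (shift-⇉ (suc c) p)
shift-⇉ c (papp p q)   = papp (shift-⇉ c p) (shift-⇉ c q)
shift-⇉ c (pbeta {t' = t'} {u' = u'} p q)
  rewrite shift-[] c u' t' = pbeta (shift-⇉ (suc c) p) (shift-⇉ c q)

subst-⇉ : ∀ j {t t' s s'} → t ⇉ t' → s ⇉ s' → subst j s t ⇉ subst j s' t'
subst-⇉ j (pvar {x}) q with x ≡ᵇ j
... | true  = q
... | false = ⇉-refl _
subst-⇉ j (plam p)   q = plam (subst-⇉ (suc j) p (shift-⇉ 0 q))
subst-⇉ j (papp p r) q = papp (subst-⇉ j p q) (subst-⇉ j r q)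
subst-⇉ j {s' = s'} (pbeta {t' = t'} {u' = u'} p r) q
  rewrite subst-[] j s' u' t' = pbeta (subst-⇉ (suc j) p (shift-⇉ 0 q)) (subst-⇉ j r q)

data _→w_ : Λ → Λ → Set where
  wβ   : ∀ {u v} → app (lam u) v →w u [ v ]
  wapp : ∀ {t t' w} → t →w t' → app t w →w app t' w

_↠w_ : Λ → Λ → Set
_↠w_ = Star _→w_

wβ≡ : ∀ {u v w} → u [ v ] ≡ w → app (lam u) v →w w
wβ≡ refl = wβ

↠w-appˡ : ∀ {t t'} w → t ↠w t' → app t w ↠w app t' w
↠w-appˡ w ε        = ε
↠w-appˡ w (r ◅ rs) = wapp r ◅ ↠w-appˡ w rs

→w-source-NotLam : ∀ {t t'} → t →w t' → NotLam t
→w-source-NotLam wβ       = tt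
→w-source-NotLam (wapp _) = tt

→w⇒→h : ∀ {t t'} → t →w t' → t →h t'
→w⇒→h wβ       = hβ
→w⇒→h (wapp r) = happ (→w-source-NotLam r) (→w⇒→h r)

↠w⇒≻ : ∀ {t t'} → t ↠w t' → t ≻ t'
↠w⇒≻ ε        = ε
↠w⇒≻ (r ◅ rs) = →w⇒→h r ◅ ↠w⇒≻ rs

subst-→w : ∀ j s {t t'} → t →w t' → subst j s t →w subst j s t'
subst-→w j s (wβ {u} {v}) rewrite subst-[] j s v u = wβ
subst-→w j s (wapp r)     = wapp (subst-→w j s r)

subst-↠w : ∀ j s {t t'} → t ↠w t' → subst j s t ↠w subst j s t'
subst-↠w j s ε        = ε
subst-↠w j s (r ◅ rs) = subst-→w j s r ◅ subst-↠w j s rs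

-- Parallel reduction that contracts no redex in weak head position.
data _⇉ᵢ_ : Λ → Λ → Set where
  ivar : ∀ {x} → var x ⇉ᵢ var x
  ilam : ∀ {t t'} → t ⇉ t' → lam t ⇉ᵢ lam t'
  iapp : ∀ {t t' u u'} → t ⇉ᵢ t' → u ⇉ u' → app t u ⇉ᵢ app t' u'

_↠w⇉ᵢ_ : Λ → Λ → Set
M ↠w⇉ᵢ N = ∃ λ L → M ↠w L × L ⇉ᵢ N

↠w⇉ᵢ-appˡ : ∀ {t t' u u'} → t ↠w⇉ᵢ t' → u ⇉ u' → app t u ↠w⇉ᵢ app t' u'
↠w⇉ᵢ-appˡ {u = u} (L , t↠L , L⇉t') q = app L u , ↠w-appˡ u t↠L , iapp L⇉t' q

[]-↠w⇉ᵢ : ∀ {c c' b b'} → c ⇉ᵢ c' → b ⇉ b' → b ↠w⇉ᵢ b' → c [ b ] ↠w⇉ᵢ c' [ b' ]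
[]-↠w⇉ᵢ (ivar {zero})  _ b↠b' = b↠b'
[]-↠w⇉ᵢ (ivar {suc x}) _ _    = var x , ε , ivar
[]-↠w⇉ᵢ (ilam p)       q _    = _ , ε , ilam (subst-⇉ 1 p (shift-⇉ 0 q))
[]-↠w⇉ᵢ (iapp p r)     q b↠b' = ↠w⇉ᵢ-appˡ ([]-↠w⇉ᵢ p q b↠b') (subst-⇉ 0 r q)

⇉⇒↠w⇉ᵢ : ∀ {M N} → M ⇉ N → M ↠w⇉ᵢ N
⇉⇒↠w⇉ᵢ pvar       = _ , ε , ivar
⇉⇒↠w⇉ᵢ (plam p)   = _ , ε , ilam p
⇉⇒↠w⇉ᵢ (papp p q) = ↠w⇉ᵢ-appˡ (⇉⇒↠w⇉ᵢ p) q
⇉⇒↠w⇉ᵢ (pbeta {u = b} p q) with ⇉⇒↠w⇉ᵢ p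
... | c₁ , c↠c₁ , c₁⇉c' with []-↠w⇉ᵢ c₁⇉c' q (⇉⇒↠w⇉ᵢ q)
...   | L , r , L⇉N = L , wβ ◅ subst-↠w 0 b c↠c₁ ◅◅ r , L⇉N

⇉ᵢ-→w-postpone : ∀ {L N N'} → L ⇉ᵢ N → N →w N' → ∃ λ L' → L →w L' × L' ⇉ N'
⇉ᵢ-→w-postpone (iapp (ilam p) q) wβ       = _ , wβ , subst-⇉ 0 p q
⇉ᵢ-→w-postpone (iapp i q)        (wapp r) with ⇉ᵢ-→w-postpone i r
... | L' , L→L' , L'⇉N' = _ , wapp L→L' , papp L'⇉N' q

⇉-↠w-var : ∀ {M N x} → M ⇉ N → N ↠w var x → M ↠w var x
⇉-↠w-var p ε with ⇉⇒↠w⇉ᵢ p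
... | _ , M↠L , ivar = M↠L
⇉-↠w-var p (r ◅ rs) with ⇉⇒↠w⇉ᵢ p
... | _ , M↠L , L⇉N with ⇉ᵢ-→w-postpone L⇉N r
...   | _ , L→L' , L'⇉N' = M↠L ◅◅ L→L' ◅ ⇉-↠w-var L'⇉N' rs

→w-⇉-commute : ∀ {M M' N} → M →w M' → M ⇉ N → ∃ λ N' → N ↠w N' × M' ⇉ N'
→w-⇉-commute wβ       (papp (plam p) q) = _ , wβ ◅ ε , subst-⇉ 0 p q
→w-⇉-commute wβ       (pbeta p q)       = _ , ε , subst-⇉ 0 p q
→w-⇉-commute (wapp r) (papp p q) with →w-⇉-commute r p
... | _ , N↠N' , M'⇉N' = _ , ↠w-appˡ _ N↠N' , papp M'⇉N' q

⇉-preserves-↠w-var : ∀ {M N x} → M ⇉ N → M ↠w var x → N ↠w var x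
⇉-preserves-↠w-var pvar ε        = ε
⇉-preserves-↠w-var p    (r ◅ rs) with →w-⇉-commute r p
... | _ , N↠N' , M'⇉N' = N↠N' ◅◅ ⇉-preserves-↠w-var M'⇉N' rs

≃β-var⇒↠w : ∀ {M x} → M ≃β var x → M ↠w var x
≃β-var⇒↠w ε            = ε
≃β-var⇒↠w (fwd r ◅ rs) = ⇉-↠w-var (→β⇒⇉ r) (≃β-var⇒↠w rs)
≃β-var⇒↠w (bwd r ◅ rs) = ⇉-preserves-↠w-var (→β⇒⇉ r) (≃β-var⇒↠w rs)

Bound : ℕ → Λ → Set
Bound j t = ∀ k → k ∈FV t → k < j

bound-var : ∀ {j x} → x < j → Bound j (var x)
bound-var x<j _ here = x<j

bound-lam : ∀ {j t} → Bound (suc j) t → Bound j (lam t)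
bound-lam b k (under k∈t) with b (suc k) k∈t
... | s≤s k<j = k<j

bound-lam⁻ : ∀ {j t} → Bound j (lam t) → Bound (suc j) t
bound-lam⁻ b zero    _   = z<s
bound-lam⁻ b (suc k) k∈t = s≤s (b k (under k∈t))

bound-app : ∀ {j t u} → Bound j t → Bound j u → Bound j (app t u)
bound-app bt _  k (appˡ k∈t) = bt k k∈t
bound-app _  bu k (appʳ k∈u) = bu k k∈u

bound-weaken : ∀ {i j t} → i ≤ j → Bound i t → Bound j t
bound-weaken i≤j b k k∈t = <-≤-trans (b k k∈t) i≤j

closed⇒bound : ∀ {j t} → Closed t → Bound j t
closed⇒bound c k k∈t = ⊥-elim (c k k∈t)

bound⇒closed : ∀ {t} → Bound 0 t → Closed t
bound⇒closed b k k∈t with b k k∈t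
... | ()

closed-app : ∀ {t u} → Closed t → Closed u → Closed (app t u)
closed-app ct _  k (appˡ k∈t) = ct k k∈t
closed-app _  cu k (appʳ k∈u) = cu k k∈u

subst-bound : ∀ j s t → Bound j t → subst j s t ≡ t
subst-bound j s (var x)   b = subst-var-< (b x here)
subst-bound j s (lam t)   b = cong lam (subst-bound (suc j) (shift 0 s) t (bound-lam⁻ b))
subst-bound j s (app t u) b =
  cong₂ app (subst-bound j s t (λ k → b k ∘ appˡ)) (subst-bound j s u (λ k → b k ∘ appʳ))

shift-bound : ∀ c t → Bound c t → shift c t ≡ t
shift-bound c (var x)   b = shift-var-< (b x here)
shift-bound c (lam t)   b = cong lam (shift-bound (suc c) t (bound-lam⁻ b))
shift-bound c (app t u) b =
  cong₂ app (shift-bound c t (λ k → b k ∘ appˡ)) (shift-bound c u (λ k → b k ∘ appʳ))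

subst-closed : ∀ {t} → Closed t → ∀ j s → subst j s t ≡ t
subst-closed c j s = subst-bound j s _ (closed⇒bound c)

shift-closed : ∀ {t} → Closed t → ∀ c → shift c t ≡ t
shift-closed cl c = shift-bound c _ (closed⇒bound cl)

fresh : Λ → ℕ
fresh (var x)   = suc x
fresh (lam t)   = pred (fresh t)
fresh (app t u) = fresh t ⊔ fresh u

bound-fresh : ∀ t → Bound (fresh t) t
bound-fresh (var x)   _ here = ≤-refl
bound-fresh (lam t)   k (under k∈t) with fresh t | bound-fresh t (suc k) k∈t
... | suc _ | s≤s k<j = k<j
bound-fresh (app t u) k (appˡ k∈t) = <-≤-trans (bound-fresh t k k∈t) (m≤m⊔n _ _)
bound-fresh (app t u) k (appʳ k∈u) = <-≤-trans (bound-fresh u k k∈u) (m≤n⊔m _ _)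

≃β-appˡ : ∀ {X Y} w → X ≃β Y → app X w ≃β app Y w
≃β-appˡ w = gmap (λ X → app X w) ξappˡ

≃β-appʳ : ∀ {X Y} w → X ≃β Y → app w X ≃β app w Y
≃β-appʳ w = gmap (app w) ξappʳ

instantiate-fresh : ∀ M {X Y} r → Closed Y →
                    app (app M (var (fresh M))) (var (suc (fresh M))) ↠w var r →
                    app (app M X) Y ↠w subst (fresh M) X (subst (suc (fresh M)) Y (var r))
instantiate-fresh M {X} {Y} r Y-closed red =
  transport (_↠w subst x X (subst (suc x) Y (var r))) instantiated
            (subst-↠w x X (subst-↠w (suc x) Y red))
  where
  x = fresh M
  instantiated : subst x X (subst (suc x) Y (app (app M (var x)) (var (suc x)))) ≡ app (app M X) Y
  instantiated
    rewrite subst-bound (suc x) Y M (bound-weaken (n≤1+n x) (bound-fresh M))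
          | subst-var-< {s = Y} (n<1+n x) | subst-var-≡ {suc x} {Y}
          | subst-bound x X M (bound-fresh M) | subst-var-≡ {x} {X}
          | subst-closed Y-closed x X = refl

T-selects-first : ∀ {M} X {Y} → Closed Y → M ≃β T → app (app M X) Y ↠w X
T-selects-first {M} X {Y} Y-closed M≃T =
  transport (app (app M X) Y ↠w_) selected
            (instantiate-fresh M x Y-closed (≃β-var⇒↠w M-x-y≃x))
  where
  x = fresh M
  M-x-y≃x : app (app M (var x)) (var (suc x)) ≃β var x
  M-x-y≃x = ≃β-appˡ _ (≃β-appˡ _ M≃T) ◅◅ fwd (ξappˡ beta) ◅ fwd beta ◅ ε
  selected : subst x X (subst (suc x) Y (var x)) ≡ X
  selected rewrite subst-var-< {s = Y} (n<1+n x) = subst-var-≡ {x}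

F-selects-second : ∀ {M} X {Y} → Closed Y → M ≃β F → app (app M X) Y ↠w Y
F-selects-second {M} X {Y} Y-closed M≃F =
  transport (app (app M X) Y ↠w_) selected
            (instantiate-fresh M (suc x) Y-closed (≃β-var⇒↠w M-x-y≃y))
  where
  x = fresh M
  M-x-y≃y : app (app M (var x)) (var (suc x)) ≃β var (suc x)
  M-x-y≃y = ≃β-appˡ _ (≃β-appˡ _ M≃F) ◅◅ fwd (ξappˡ beta) ◅ fwd beta ◅ ε
  selected : subst x X (subst (suc x) Y (var (suc x))) ≡ Y
  selected rewrite subst-var-≡ {suc x} {Y} = subst-closed Y-closed x X

module StorageOperator (Z P S d₀ : Λ) (Z-closed : Closed Z) (P-closed : Closed P)
                       (S-closed : Closed S) (d₀-closed : Closed d₀) where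

  Θ-half Θ A₀ : Λ
  Θ-half = lam (lam (app (var 0) (app (app (var 1) (var 1)) (var 0))))
  Θ      = app Θ-half Θ-half
  A₀     = lam (lam (app (var 0) d₀))

  -- B o = λθ f. o (P θ) (λx. f (S x)); the argument o is put under the two binders
  -- without shifting, so B (var 3) in H refers to the bound o.
  B : Λ → Λ
  B o = lam (lam (app (app o (app P (var 1))) (lam (app (var 1) (app S (var 0))))))

  H O : Λ
  H = lam (lam (app (app (app (app Z (var 0)) A₀) (B (var 3))) (var 0)))
  O = app Θ H

  A₀-closed : Closed A₀
  A₀-closed =
    bound⇒closed (bound-lam (bound-lam (bound-app (bound-var z<s) (closed⇒bound d₀-closed))))

  B-bound : ∀ {j o} → Bound (suc (suc j)) o → Bound j (B o)
  B-bound o-bound =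
    bound-lam (bound-lam (bound-app
      (bound-app o-bound (bound-app (closed⇒bound P-closed) (bound-var sz<ss)))
      (bound-lam (bound-app (bound-var sz<ss)
                            (bound-app (closed⇒bound S-closed) (bound-var z<s))))))

  B-closed : ∀ {o} → Closed o → Closed (B o)
  B-closed o-closed = bound⇒closed (B-bound (closed⇒bound o-closed))

  O-closed : Closed O
  O-closed = bound⇒closed (bound-app (bound-app Θ-half-bound Θ-half-bound) H-bound)
    where
    Θ-half-bound : Bound 0 Θ-half
    Θ-half-bound =
      bound-lam (bound-lam (bound-app (bound-var z<s)
        (bound-app (bound-app (bound-var sz<ss) (bound-var sz<ss)) (bound-var z<s))))
    H-bound : Bound 0 H
    H-bound =
      bound-lam (bound-lam (bound-app
        (bound-app (bound-app (bound-app (closed⇒bound Z-closed) (bound-var z<s))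
                              (closed⇒bound A₀-closed))
                   (B-bound (bound-var (s<s (s<s sz<ss)))))
        (bound-var z<s)))

  H-step : ∀ {o} → Closed o → ∀ θ → app (app H o) θ ↠w app (app (app (app Z θ) A₀) (B o)) θ
  H-step {o} o-closed θ = wapp (wβ≡ H-o) ◅ wβ≡ H-o-θ ◅ ε
    where
    H-o : subst 0 o (lam (app (app (app (app Z (var 0)) A₀) (B (var 3))) (var 0)))
            ≡ lam (app (app (app (app Z (var 0)) A₀) (B o)) (var 0))
    H-o rewrite shift-closed o-closed 0 | shift-closed o-closed 0 | shift-closed o-closed 0
              | shift-closed o-closed 0
              | subst-closed Z-closed 1 o | subst-closed d₀-closed 3 o
              | subst-closed P-closed 3 o | subst-closed S-closed 4 o = refl
    H-o-θ : subst 0 θ (app (app (app (app Z (var 0)) A₀) (B o)) (var 0))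
              ≡ app (app (app (app Z θ) A₀) (B o)) θ
    H-o-θ rewrite subst-closed Z-closed 0 θ | subst-closed A₀-closed 0 θ
                | subst-closed (B-closed o-closed) 0 θ = refl

  O-unfold : ∀ θ g → app (app O θ) g ↠w app (app (app (app (app Z θ) A₀) (B O)) θ) g
  O-unfold θ g = ↠w-appˡ g (↠w-appˡ θ (wapp wβ ◅ wβ ◅ ε) ◅◅ H-step O-closed θ)

  A₀-step : ∀ θ g → app (app A₀ θ) g ↠w app g d₀
  A₀-step θ g = wapp (wβ≡ A₀-θ) ◅ wβ≡ A₀-θ-g ◅ ε
    where
    A₀-θ : lam (app (var 0) d₀) [ θ ] ≡ lam (app (var 0) d₀)
    A₀-θ rewrite subst-closed d₀-closed 1 (shift 0 θ) = refl
    A₀-θ-g : app (var 0) d₀ [ g ] ≡ app g d₀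
    A₀-θ-g rewrite subst-closed d₀-closed 0 g = refl

  B-step : ∀ {o} → Closed o → ∀ θ g →
           app (app (B o) θ) g ↠w app (app o (app P θ)) (lam (app (shift 0 g) (app S (var 0))))
  B-step {o} o-closed θ g = wapp (wβ≡ B-o-θ) ◅ wβ≡ B-o-θ-g ◅ ε
    where
    B-o-θ : lam (app (app o (app P (var 1))) (lam (app (var 1) (app S (var 0))))) [ θ ]
              ≡ lam (app (app o (app P (shift 0 θ))) (lam (app (var 1) (app S (var 0)))))
    B-o-θ rewrite subst-closed o-closed 1 (shift 0 θ) | subst-closed P-closed 1 (shift 0 θ)
                | subst-closed S-closed 2 (shift 0 (shift 0 θ)) = refl
    B-o-θ-g : app (app o (app P (shift 0 θ))) (lam (app (var 1) (app S (var 0)))) [ g ]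
                ≡ app (app o (app P θ)) (lam (app (shift 0 g) (app S (var 0))))
    B-o-θ-g rewrite subst-closed o-closed 0 g | subst-closed P-closed 0 g | subst-shift 0 g θ
                  | subst-closed S-closed 1 (shift 0 g) = refl

  S-wrap-step : ∀ g t → app (lam (app (shift 0 g) (app S (var 0)))) t →w app g (app S t)
  S-wrap-step g t = wβ≡ S-wrap-t
    where
    S-wrap-t : app (shift 0 g) (app S (var 0)) [ t ] ≡ app g (app S t)
    S-wrap-t rewrite subst-shift 0 t g | subst-closed S-closed 0 t = refl

module AdequateNumerals (d : ℕ → Λ) (numerals : NumeralSystem d) (P : Λ) (P-closed : Closed P)
                        (P-spec : ∀ n → app P (d (suc n)) ≃β d n) where

  open NumeralSystem numerals
  open StorageOperator Z P S (d 0) Z-closed P-closed S-closed (closed 0) public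

  Sⁿd₀ : ℕ → Λ
  Sⁿd₀ zero    = d 0
  Sⁿd₀ (suc n) = app S (Sⁿd₀ n)

  Sⁿd₀-closed : ∀ n → Closed (Sⁿd₀ n)
  Sⁿd₀-closed zero    = closed 0
  Sⁿd₀-closed (suc n) = closed-app S-closed (Sⁿd₀-closed n)

  Sⁿd₀≃βdₙ : ∀ n → Sⁿd₀ n ≃β d n
  Sⁿd₀≃βdₙ zero    = ε
  Sⁿd₀≃βdₙ (suc n) = ≃β-appʳ S (Sⁿd₀≃βdₙ n) ◅◅ S-spec n

  O-stores : ∀ n θ g → θ ≃β d n → app (app O θ) g ↠w app g (Sⁿd₀ n)
  O-stores zero θ g θ≃d₀ =
    O-unfold θ g ◅◅ ↠w-appˡ g (↠w-appˡ θ (T-selects-first A₀ (B-closed O-closed) Zθ≃T))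
                 ◅◅ A₀-step θ g
    where
    Zθ≃T : app Z θ ≃β T
    Zθ≃T = ≃β-appʳ Z θ≃d₀ ◅◅ Z-zero
  O-stores (suc n) θ g θ≃dₙ₊₁ =
    O-unfold θ g ◅◅ ↠w-appˡ g (↠w-appˡ θ (F-selects-second A₀ (B-closed O-closed) Zθ≃F))
                 ◅◅ B-step O-closed θ g
                 ◅◅ O-stores n (app P θ) _ (≃β-appʳ P θ≃dₙ₊₁ ◅◅ P-spec n)
                 ◅◅ S-wrap-step g (Sⁿd₀ n) ◅ ε
    where
    Zθ≃F : app Z θ ≃β F
    Zθ≃F = ≃β-appʳ Z θ≃dₙ₊₁ ◅◅ Z-suc n

mainTheorem1 : (d : ℕ → Λ) → Adequate d → HasStorageOperator d
mainTheorem1 d (numerals , P , P-closed , P-spec) =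
  O , O-closed ,
  λ n → Sⁿd₀ n , Sⁿd₀-closed n , Sⁿd₀≃βdₙ n ,
        λ θ θ≃dₙ f _ → ↠w⇒≻ (O-stores n θ (var f) θ≃dₙ)
  where open AdequateNumerals d numerals P P-closed P-spec
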